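{- Let $SO_1(G)=\frac{1}{2}\sum_{uv\in E(G)}|d_u^2-d_v^2|$. For every $n\geq 2$: (i) $SO_1(T_n)=12n$, where $T_n$ is the chain triangular cactus of order $n$; (ii) $SO_1(Q_n)=24n-24$, where $Q_n$ is the para-chain square cactus of order $n$; (iii) $SO_1(O_n)=12n$, where $O_n$ is the ortho-chain square cactus of order $n$; (iv) $SO_1(O_n^h)=12n$, where $O_n^h$ is the ortho-chain hexagonal cactus of order $n$; (v) $SO_1(L_n)=24n-24$, where $L_n$ is the para-chain hexagonal cactus of order $n$; (vi) $SO_1(M_n)=24n-24$, where $M_n$ is the meta-chain hexagonal cactus of order $n$.
   Context: $d_v$ denotes the degree of vertex $v$. A cactus chain of order $n$ built from cycles $C_k$ is a graph consisting of $n$ copies $B_1,\dots,B_n$ of the cycle $C_k$ such that for each $i=1,\dots,n-1$, $B_i$ and $B_{i+1}$ share exactly one vertex $c_i$, and non-consecutive copies share no vertex. $T_n$ is such a chain with $k=3$ (all choices give isomorphic graphs). For $k=4$: in the para-chain square cactus $Q_n$ the two shared vertices $c_{i-1},c_i$ of each $B_i$ ($2\le i\le n-1$) are at distance $2$ in $B_i$; in the ortho-chain square cactus $O_n$ they are adjacent in $B_i$. For $k=6$: in the ortho-chain hexagonal cactus $O_n^h$ they are adjacent in $B_i$; in the meta-chain hexagonal cactus $M_n$ they are at distance $2$ in $B_i$; in the para-chain hexagonal cactus $L_n$ they are at distance $3$ in $B_i$. -}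

module Defs where

open import Data.Nat using (ℕ; zero; suc; _+_; _*_; _∸_; _^_; _≡ᵇ_; ∣_-_∣; _/_)
open import Data.Bool using (if_then_else_)
open import Data.Product using (_×_; _,_)
open import Data.List using (List; []; _∷_; _++_; map; upTo; concatMap)
open import Data.Nat.ListAction using (sum)

-- A finite graph is given by its list of edges; an edge is an (unordered)
-- pair of vertex labels, stored as an ordered pair.
Graph : Set
Graph = List (ℕ × ℕ)

incid : ℕ → ℕ × ℕ → ℕ
incid v (a , b) = (if a ≡ᵇ v then 1 else 0) + (if b ≡ᵇ v then 1 else 0)

deg : Graph → ℕ → ℕ
deg G v = sum (map (incid v) G)

SO1 : Graph → ℕ
SO1 G = sum (map (λ { (u , v) → ∣ deg G u ^ 2 - deg G v ^ 2 ∣ }) G) / 2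

-- Block B_i (i = 0 … n-1) is a k-cycle
-- whose positions 0,1,…,k-1 are in cyclic order.  Position 0 of B_(i+1) is
-- the vertex at position d of B_i (the shared cut vertex c_i), so that in
-- every block the two shared vertices c_(i-1) (position 0) and c_i
-- (position d) are at distance d (for 1 ≤ d ≤ k/2).  All other positions
-- are fresh vertices.
-- vid k d i p = global label of position p of block i.
vid : ℕ → ℕ → ℕ → ℕ → ℕ
vid k d zero    p       = p
vid k d (suc i) zero    = vid k d i d
vid k d (suc i) (suc p) = k + i * (k ∸ 1) + p

block : ℕ → ℕ → ℕ → Graph
block k d i =
  map (λ p → vid k d i p , vid k d i (suc p)) (upTo (k ∸ 1))
  ++ ((vid k d i (k ∸ 1) , vid k d i 0) ∷ [])

cactusChain : ℕ → ℕ → ℕ → Graph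
cactusChain k d n = concatMap (block k d) (upTo n)

T : ℕ → Graph
T = cactusChain 3 1

Q : ℕ → Graph
Q = cactusChain 4 2

O : ℕ → Graph
O = cactusChain 4 1

Oh : ℕ → Graph
Oh = cactusChain 6 1

M : ℕ → Graph
M = cactusChain 6 2

L : ℕ → Graph
L = cactusChain 6 3

{-# OPTIONS --safe #-}
module Submission where

-- Every vertex of a cactus chain has degree 2 except the cut vertices, which have degree 4, so an
-- edge contributes |4² − 2²| = 12 exactly when it joins a cut vertex to a vertex of degree 2.  An
-- end block has one cut vertex and contributes 24; an inner block contributes 24 when its two cut
-- vertices are adjacent (the edge between them contributes 0) and 48 otherwise.  The degrees are
-- found by counting: running over all positions of all blocks visits every vertex once, and each
-- cut vertex c_j once more, as position 0 of block j + 1.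

open import Defs
open import Data.Bool using (Bool; true; false; _∧_; if_then_else_)
open import Data.Empty using (⊥-elim)
open import Data.List using (List; []; _∷_; _++_; map; upTo; applyUpTo; concatMap)
open import Data.List.Properties using (map-++; map-∘; map-cong)
open import Data.Nat
  using (ℕ; zero; suc; _+_; _*_; _∸_; _^_; ∣_-_∣; _/_; _≤_; _<_; z≤n; s≤s; z<s; s<s;
         _≡ᵇ_; _<ᵇ_; NonZero; >-nonZero)
open import Data.Nat.Divisibility using (n∣m*n)
open import Data.Nat.DivMod using (_%_; m*n/n≡m; m<n⇒m%n≡m; %-remove-+ˡ)
open import Data.Nat.ListAction using (sum)
open import Data.Nat.ListAction.Properties using (sum-++)
open import Data.Nat.Properties
open import Algebra.Properties.CommutativeSemigroup +-commutativeSemigroup using (interchange)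
open import Data.Nat.Tactic.RingSolver using (solve-∀)
open import Data.Product using (_×_; _,_; proj₁)
open import Function using (_∘_; _⇔_; mk⇔)
open import Relation.Binary.PropositionalEquality
  using (_≡_; refl; sym; trans; cong; cong₂; module ≡-Reasoning)
open import Relation.Nullary.Decidable using (does-⇔; dec-true; dec-false; _×-dec_)

open ≡-Reasoning

-- Via if_then_else_ rather than by matching, so that incid v (a , b) is 𝟙 (a ≡ᵇ v) + 𝟙 (b ≡ᵇ v)
-- definitionally.
𝟙 : Bool → ℕ
𝟙 b = if b then 1 else 0

𝟙-∧ : ∀ a b → 𝟙 (a ∧ b) ≡ 𝟙 a * 𝟙 b
𝟙-∧ true  b = sym (+-identityʳ (𝟙 b))
𝟙-∧ false b = refl

𝟙-<ᵇ-suc : ∀ v y → 𝟙 (v <ᵇ suc y) ≡ 𝟙 (v <ᵇ y) + 𝟙 (y ≡ᵇ v)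
𝟙-<ᵇ-suc zero    zero    = refl
𝟙-<ᵇ-suc (suc v) zero    = refl
𝟙-<ᵇ-suc zero    (suc y) = refl
𝟙-<ᵇ-suc (suc v) (suc y) = 𝟙-<ᵇ-suc v y

∑ : ℕ → (ℕ → ℕ) → ℕ
∑ zero    f = 0
∑ (suc n) f = f 0 + ∑ n (f ∘ suc)

sum-map-applyUpTo : ∀ (f g : ℕ → ℕ) n → sum (map f (applyUpTo g n)) ≡ ∑ n (f ∘ g)
sum-map-applyUpTo f g zero    = refl
sum-map-applyUpTo f g (suc n) = cong (f (g 0) +_) (sum-map-applyUpTo f (g ∘ suc) n)

sum-map-upTo : ∀ (f : ℕ → ℕ) n → sum (map f (upTo n)) ≡ ∑ n f
sum-map-upTo f = sum-map-applyUpTo f (λ i → i)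

∑-cong : ∀ {f g} n → (∀ i → i < n → f i ≡ g i) → ∑ n f ≡ ∑ n g
∑-cong zero    f≡g = refl
∑-cong (suc n) f≡g = cong₂ _+_ (f≡g 0 z<s) (∑-cong n (λ i i<n → f≡g (suc i) (s<s i<n)))

∑-distrib-+ : ∀ n f g → ∑ n (λ i → f i + g i) ≡ ∑ n f + ∑ n g
∑-distrib-+ zero    f g = refl
∑-distrib-+ (suc n) f g = begin
  f 0 + g 0 + ∑ n (λ i → f (suc i) + g (suc i))
    ≡⟨ cong (f 0 + g 0 +_) (∑-distrib-+ n (f ∘ suc) (g ∘ suc)) ⟩
  f 0 + g 0 + (∑ n (f ∘ suc) + ∑ n (g ∘ suc))
    ≡⟨ interchange (f 0) (g 0) _ _ ⟩
  f 0 + ∑ n (f ∘ suc) + (g 0 + ∑ n (g ∘ suc)) ∎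

∑-distribʳ-* : ∀ n f c → ∑ n (λ i → f i * c) ≡ ∑ n f * c
∑-distribʳ-* zero    f c = refl
∑-distribʳ-* (suc n) f c =
  trans (cong (f 0 * c +_) (∑-distribʳ-* n (f ∘ suc) c)) (sym (*-distribʳ-+ c (f 0) _))

∑-const : ∀ n c → ∑ n (λ _ → c) ≡ n * c
∑-const zero    c = refl
∑-const (suc n) c = cong (c +_) (∑-const n c)

∑-zero : ∀ n → ∑ n (λ _ → 0) ≡ 0
∑-zero n = trans (∑-const n 0) (*-zeroʳ n)

∑-last : ∀ n f → ∑ (suc n) f ≡ ∑ n f + f n
∑-last zero    f = +-identityʳ (f 0)
∑-last (suc n) f = trans (cong (f 0 +_) (∑-last n (f ∘ suc))) (sym (+-assoc (f 0) _ _))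

∑-cyclic : ∀ n f → ∑ n (λ p → f p + f (suc p)) + (f n + f 0) ≡ ∑ (suc n) f + ∑ (suc n) f
∑-cyclic n f = begin
  ∑ n (λ p → f p + f (suc p)) + (f n + f 0)
    ≡⟨ cong (_+ (f n + f 0)) (∑-distrib-+ n f (f ∘ suc)) ⟩
  ∑ n f + ∑ n (f ∘ suc) + (f n + f 0)
    ≡⟨ interchange (∑ n f) _ (f n) (f 0) ⟩
  ∑ n f + f n + (∑ n (f ∘ suc) + f 0)
    ≡⟨ cong₂ _+_ (sym (∑-last n f)) (+-comm _ (f 0)) ⟩
  ∑ (suc n) f + ∑ (suc n) f ∎

∑-𝟙-≡ᵇ : ∀ n i → ∑ n (λ j → 𝟙 (j ≡ᵇ i)) ≡ 𝟙 (i <ᵇ n)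
∑-𝟙-≡ᵇ zero    i       = refl
∑-𝟙-≡ᵇ (suc n) zero    = cong suc (∑-zero n)
∑-𝟙-≡ᵇ (suc n) (suc i) = ∑-𝟙-≡ᵇ n i

∑-𝟙-suc≡ᵇ : ∀ n i → i ≤ n → ∑ n (λ j → 𝟙 (suc j ≡ᵇ i)) ≡ 𝟙 (0 <ᵇ i)
∑-𝟙-suc≡ᵇ n zero    _   = ∑-zero n
∑-𝟙-suc≡ᵇ n (suc i) i<n = trans (∑-𝟙-≡ᵇ n i) (cong 𝟙 (dec-true (i <? n) i<n))

∑-𝟙-interval : ∀ x n v → 𝟙 (v <ᵇ x) + ∑ n (λ q → 𝟙 (x + q ≡ᵇ v)) ≡ 𝟙 (v <ᵇ x + n)
∑-𝟙-interval x zero    v =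
  trans (+-identityʳ _) (cong (λ y → 𝟙 (v <ᵇ y)) (sym (+-identityʳ x)))
∑-𝟙-interval x (suc n) v = begin
  𝟙 (v <ᵇ x) + ∑ (suc n) g         ≡⟨ cong (𝟙 (v <ᵇ x) +_) (∑-last n g) ⟩
  𝟙 (v <ᵇ x) + (∑ n g + g n)       ≡⟨ sym (+-assoc (𝟙 (v <ᵇ x)) _ _) ⟩
  𝟙 (v <ᵇ x) + ∑ n g + g n         ≡⟨ cong (_+ g n) (∑-𝟙-interval x n v) ⟩
  𝟙 (v <ᵇ x + n) + 𝟙 (x + n ≡ᵇ v) ≡⟨ sym (𝟙-<ᵇ-suc v (x + n)) ⟩
  𝟙 (v <ᵇ suc (x + n))             ≡⟨ cong (λ y → 𝟙 (v <ᵇ y)) (sym (+-suc x n)) ⟩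
  𝟙 (v <ᵇ x + suc n)               ∎
  where
  g : ℕ → ℕ
  g q = 𝟙 (x + q ≡ᵇ v)

sum-map-concatMap : ∀ {A B : Set} (h : B → ℕ) (f : A → List B) xs →
  sum (map h (concatMap f xs)) ≡ sum (map (λ x → sum (map h (f x))) xs)
sum-map-concatMap h f []       = refl
sum-map-concatMap h f (x ∷ xs) = begin
  sum (map h (f x ++ concatMap f xs))              ≡⟨ cong sum (map-++ h (f x) _) ⟩
  sum (map h (f x) ++ map h (concatMap f xs))      ≡⟨ sum-++ (map h (f x)) _ ⟩
  sum (map h (f x)) + sum (map h (concatMap f xs))
    ≡⟨ cong (sum (map h (f x)) +_) (sum-map-concatMap h f xs) ⟩
  sum (map h (f x)) + sum (map (λ x → sum (map h (f x))) xs) ∎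

squareGap : ℕ → ℕ → ℕ
squareGap x y = ∣ x ^ 2 - y ^ 2 ∣

irregularity : Graph → ℕ × ℕ → ℕ
irregularity G (u , v) = squareGap (deg G u) (deg G v)

SO1-irregularity : ∀ G → SO1 G ≡ sum (map (irregularity G) G) / 2
SO1-irregularity G = cong (λ xs → sum xs / 2) (map-cong (λ { (u , v) → refl }) G)

-- Parametrised by s = k − 1 and d' = d − 1, so that the k ∸ 1 inside vid reduces; any distance
-- 1 ≤ d ≤ k − 1 between the two cut vertices of a block is allowed.
module CactusChain (s d' : ℕ) (d'<s : d' < s) where

  k d : ℕ
  k = suc s
  d = suc d'

  private instance
    s-nonZero : NonZero s
    s-nonZero = >-nonZero (≤-<-trans z≤n d'<s)

  E : ℕ → Graph
  E = cactusChain k d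

  V : ℕ → ℕ → ℕ
  V = vid k d

  sum-map-block : ∀ (h : ℕ × ℕ → ℕ) i →
    sum (map h (block k d i)) ≡ ∑ s (λ p → h (V i p , V i (suc p))) + h (V i s , V i 0)
  sum-map-block h i = begin
    sum (map h (map edge (upTo s) ++ closing ∷ []))   ≡⟨ cong sum (map-++ h (map edge (upTo s)) _) ⟩
    sum (map h (map edge (upTo s)) ++ h closing ∷ []) ≡⟨ sum-++ (map h (map edge (upTo s))) _ ⟩
    sum (map h (map edge (upTo s))) + (h closing + 0) ≡⟨ cong₂ _+_ path (+-identityʳ _) ⟩
    ∑ s (h ∘ edge) + h closing                        ∎
    where
    edge : ℕ → ℕ × ℕ
    edge p = V i p , V i (suc p)
    closing : ℕ × ℕ
    closing = V i s , V i 0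
    path : sum (map h (map edge (upTo s))) ≡ ∑ s (h ∘ edge)
    path = trans (cong sum (sym (map-∘ (upTo s)))) (sum-map-upTo (h ∘ edge) s)

  sum-map-cactusChain : ∀ (h : ℕ × ℕ → ℕ) n →
    sum (map h (E n)) ≡ ∑ n (λ i → sum (map h (block k d i)))
  sum-map-cactusChain h n = trans (sum-map-concatMap h (block k d) (upTo n)) (sum-map-upTo _ n)

  occurrences : ℕ → ℕ → ℕ
  occurrences i v = ∑ k (λ p → 𝟙 (V i p ≡ᵇ v))

  cuts : ℕ → ℕ → ℕ
  cuts m v = ∑ m (λ j → 𝟙 (V j d ≡ᵇ v))

  deg-block : ∀ i v → deg (block k d i) v ≡ occurrences i v + occurrences i v
  deg-block i v = trans (sum-map-block (incid v) i) (∑-cyclic s (λ p → 𝟙 (V i p ≡ᵇ v)))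

  ∑-occurrences : ∀ m v → ∑ (suc m) (λ j → occurrences j v) ≡ 𝟙 (v <ᵇ k + m * s) + cuts m v
  ∑-occurrences zero    v =
    cong (_+ 0) (trans (∑-𝟙-interval 0 k v) (cong (λ y → 𝟙 (v <ᵇ y)) (sym (+-identityʳ k))))
  ∑-occurrences (suc m) v = begin
    ∑ (suc (suc m)) (λ j → occurrences j v)
      ≡⟨ ∑-last (suc m) (λ j → occurrences j v) ⟩
    ∑ (suc m) (λ j → occurrences j v) + (cut + fresh)
      ≡⟨ cong₂ _+_ (∑-occurrences m v) (+-comm cut fresh) ⟩
    𝟙 (v <ᵇ x) + cuts m v + (fresh + cut)
      ≡⟨ interchange (𝟙 (v <ᵇ x)) (cuts m v) fresh cut ⟩
    𝟙 (v <ᵇ x) + fresh + (cuts m v + cut)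
      ≡⟨ cong₂ _+_ (∑-𝟙-interval x s v) (sym (∑-last m (λ j → 𝟙 (V j d ≡ᵇ v)))) ⟩
    𝟙 (v <ᵇ x + s) + cuts (suc m) v
      ≡⟨ cong (λ y → 𝟙 (v <ᵇ y) + cuts (suc m) v) x+s≡ ⟩
    𝟙 (v <ᵇ k + suc m * s) + cuts (suc m) v ∎
    where
    x cut fresh : ℕ
    x = k + m * s
    cut = 𝟙 (V m d ≡ᵇ v)
    fresh = ∑ s (λ q → 𝟙 (x + q ≡ᵇ v))
    x+s≡ : x + s ≡ k + suc m * s
    x+s≡ = trans (+-assoc k (m * s) s) (cong (k +_) (+-comm (m * s) s))

  deg-cactusChain : ∀ m v → deg (E (suc m)) v ≡ 2 * (𝟙 (v <ᵇ k + m * s) + cuts m v)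
  deg-cactusChain m v = begin
    deg (E (suc m)) v                     ≡⟨ sum-map-cactusChain (incid v) (suc m) ⟩
    ∑ (suc m) (λ i → deg (block k d i) v) ≡⟨ ∑-cong (suc m) (λ i _ → deg-block i v) ⟩
    ∑ (suc m) (λ i → occ i + occ i)       ≡⟨ ∑-distrib-+ (suc m) occ occ ⟩
    ∑ (suc m) occ + ∑ (suc m) occ         ≡⟨ cong (λ y → y + y) (∑-occurrences m v) ⟩
    t + t                                 ≡⟨ cong (t +_) (sym (+-identityʳ t)) ⟩
    2 * t                                 ∎
    where
    occ : ℕ → ℕ
    occ i = occurrences i v
    t : ℕ
    t = 𝟙 (v <ᵇ k + m * s) + cuts m v

  vid-bound : ∀ i p → p ≤ s → V i p < k + i * s
  vid-bound zero    zero    _   = z<s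
  vid-bound zero    (suc p) p<s = s<s (≤-trans p<s (m≤m+n s 0))
  vid-bound (suc i) zero    _   = <-≤-trans (vid-bound i d d'<s) (+-monoʳ-≤ k (m≤n+m (i * s) s))
  vid-bound (suc i) (suc p) p<s = <-≤-trans (+-monoʳ-< (k + i * s) p<s)
    (≤-reflexive (trans (+-assoc k (i * s) s) (cong (k +_) (+-comm (i * s) s))))

  below-fresh : ∀ j a x → x ≤ s → x < V (suc j) (suc a)
  below-fresh j a x x≤s = <-≤-trans (s≤s x≤s) (≤-trans (m≤m+n k (j * s)) (m≤m+n _ a))

  fresh-injective : ∀ {j i a b} → a < s → b < s →
    V (suc j) (suc a) ≡ V (suc i) (suc b) → j ≡ i × a ≡ b
  fresh-injective {j} {i} {a} {b} a<s b<s eq = j≡i , a≡b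
    where
    eq′ : j * s + a ≡ i * s + b
    eq′ = +-cancelˡ-≡ k _ _ (trans (sym (+-assoc k _ a)) (trans eq (+-assoc k _ b)))
    a≡b : a ≡ b
    a≡b = begin
      a               ≡⟨ sym (m<n⇒m%n≡m a<s) ⟩
      a % s           ≡⟨ sym (%-remove-+ˡ a (n∣m*n j)) ⟩
      (j * s + a) % s ≡⟨ cong (_% s) eq′ ⟩
      (i * s + b) % s ≡⟨ %-remove-+ˡ b (n∣m*n i) ⟩
      b % s           ≡⟨ m<n⇒m%n≡m b<s ⟩
      b               ∎
    j≡i : j ≡ i
    j≡i = *-cancelʳ-≡ j i s (+-cancelʳ-≡ _ _ _ (trans eq′ (cong (i * s +_) (sym a≡b))))

  cut-injective : ∀ j i → V j d ≡ V i d → j ≡ i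
  cut-injective zero    zero    _  = refl
  cut-injective zero    (suc i) eq = ⊥-elim (<-irrefl eq (below-fresh i d' d d'<s))
  cut-injective (suc j) zero    eq = ⊥-elim (<-irrefl (sym eq) (below-fresh j d' d d'<s))
  cut-injective (suc j) (suc i) eq = cong suc (proj₁ (fresh-injective d'<s d'<s eq))

  -- does (x ≟ y) is x ≡ᵇ y by definition, so does-⇔ turns a characterisation of an equation
  -- between labels into one of the corresponding ≡ᵇ-test.
  cut-indicator : ∀ i p j → p ≤ s →
    𝟙 (V j d ≡ᵇ V i p) ≡ 𝟙 (suc j ≡ᵇ i) * 𝟙 (0 ≡ᵇ p) + 𝟙 (j ≡ᵇ i) * 𝟙 (d ≡ᵇ p)
  cut-indicator zero    p       zero    _   = sym (+-identityʳ _)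
  cut-indicator zero    p       (suc j) p≤s =
    cong 𝟙 (dec-false (V (suc j) d ≟ p) (λ eq → <-irrefl (sym eq) (below-fresh j d' p p≤s)))
  cut-indicator (suc i) zero    j       _   = begin
    𝟙 (V j d ≡ᵇ V i d)
      ≡⟨ cong 𝟙 (does-⇔ cut-≡⇔ (V j d ≟ V i d) (j ≟ i)) ⟩
    𝟙 (j ≡ᵇ i)
      ≡⟨ sym (trans (+-identityʳ _) (*-identityʳ _)) ⟩
    𝟙 (j ≡ᵇ i) * 1 + 0
      ≡⟨ cong (𝟙 (j ≡ᵇ i) * 1 +_) (sym (*-zeroʳ (𝟙 (j ≡ᵇ suc i)))) ⟩
    𝟙 (j ≡ᵇ i) * 1 + 𝟙 (j ≡ᵇ suc i) * 0 ∎
    where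
    cut-≡⇔ : V j d ≡ V i d ⇔ j ≡ i
    cut-≡⇔ = mk⇔ (cut-injective j i) (cong (λ j → V j d))
  cut-indicator (suc i) (suc p) zero    _   =
    trans (cong 𝟙 (dec-false (d ≟ V (suc i) (suc p)) (λ eq → <-irrefl eq (below-fresh i p d d'<s))))
          (sym (trans (+-identityʳ _) (*-zeroʳ (𝟙 (0 ≡ᵇ i)))))
  cut-indicator (suc i) (suc p) (suc j) p<s = begin
    𝟙 (V (suc j) d ≡ᵇ V (suc i) (suc p))
      ≡⟨ cong 𝟙 (does-⇔ fresh-≡⇔ (V (suc j) d ≟ V (suc i) (suc p)) (j ≟ i ×-dec d' ≟ p)) ⟩
    𝟙 ((j ≡ᵇ i) ∧ (d' ≡ᵇ p))
      ≡⟨ 𝟙-∧ (j ≡ᵇ i) (d' ≡ᵇ p) ⟩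
    𝟙 (j ≡ᵇ i) * 𝟙 (d' ≡ᵇ p)
      ≡⟨ cong (_+ 𝟙 (j ≡ᵇ i) * 𝟙 (d' ≡ᵇ p)) (sym (*-zeroʳ (𝟙 (suc j ≡ᵇ i)))) ⟩
    𝟙 (suc j ≡ᵇ i) * 0 + 𝟙 (j ≡ᵇ i) * 𝟙 (d' ≡ᵇ p) ∎
    where
    fresh-≡⇔ : V (suc j) d ≡ V (suc i) (suc p) ⇔ (j ≡ i × d' ≡ p)
    fresh-≡⇔ = mk⇔ (fresh-injective d'<s p<s) (λ { (refl , refl) → refl })

  cuts-vid : ∀ m i p → i ≤ m → p ≤ s →
    cuts m (V i p) ≡ 𝟙 (0 <ᵇ i) * 𝟙 (0 ≡ᵇ p) + 𝟙 (i <ᵇ m) * 𝟙 (d ≡ᵇ p)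
  cuts-vid m i p i≤m p≤s = begin
    cuts m (V i p)
      ≡⟨ ∑-cong m (λ j _ → cut-indicator i p j p≤s) ⟩
    ∑ m (λ j → prev j * atStart + next j * atEnd)
      ≡⟨ ∑-distrib-+ m (λ j → prev j * atStart) (λ j → next j * atEnd) ⟩
    ∑ m (λ j → prev j * atStart) + ∑ m (λ j → next j * atEnd)
      ≡⟨ cong₂ _+_ (∑-distribʳ-* m prev atStart) (∑-distribʳ-* m next atEnd) ⟩
    ∑ m prev * atStart + ∑ m next * atEnd
      ≡⟨ cong₂ (λ a b → a * atStart + b * atEnd) (∑-𝟙-suc≡ᵇ m i i≤m) (∑-𝟙-≡ᵇ m i) ⟩
    𝟙 (0 <ᵇ i) * atStart + 𝟙 (i <ᵇ m) * atEnd ∎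
    where
    prev next : ℕ → ℕ
    prev j = 𝟙 (suc j ≡ᵇ i)
    next j = 𝟙 (j ≡ᵇ i)
    atStart atEnd : ℕ
    atStart = 𝟙 (0 ≡ᵇ p)
    atEnd = 𝟙 (d ≡ᵇ p)

  cycleDegree : Bool → Bool → ℕ → ℕ
  cycleDegree hasPrev hasNext p =
    2 * (1 + (𝟙 hasPrev * 𝟙 (0 ≡ᵇ p) + 𝟙 hasNext * 𝟙 (d ≡ᵇ p)))

  deg-vid : ∀ m i p → i ≤ m → p ≤ s →
    deg (E (suc m)) (V i p) ≡ cycleDegree (0 <ᵇ i) (i <ᵇ m) p
  deg-vid m i p i≤m p≤s = trans (deg-cactusChain m (V i p))
    (cong (2 *_) (cong₂ _+_ (cong 𝟙 (dec-true (V i p <? k + m * s) inChain))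
                            (cuts-vid m i p i≤m p≤s)))
    where
    inChain : V i p < k + m * s
    inChain = <-≤-trans (vid-bound i p p≤s) (+-monoʳ-≤ k (*-monoˡ-≤ s i≤m))

  blockIrregularity : Bool → Bool → ℕ
  blockIrregularity hasPrev hasNext =
    ∑ s (λ p → squareGap (δ p) (δ (suc p))) + squareGap (δ s) (δ 0)
    where
    δ : ℕ → ℕ
    δ = cycleDegree hasPrev hasNext

  sum-irregularity-block : ∀ m i → i ≤ m →
    sum (map (irregularity (E (suc m))) (block k d i)) ≡ blockIrregularity (0 <ᵇ i) (i <ᵇ m)
  sum-irregularity-block m i i≤m = trans (sum-map-block (irregularity (E (suc m))) i)
    (cong₂ _+_ (∑-cong s (λ p p<s → cong₂ squareGap (δ≡ p (<⇒≤ p<s)) (δ≡ (suc p) p<s)))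
               (cong₂ squareGap (δ≡ s ≤-refl) (δ≡ 0 z≤n)))
    where
    δ≡ : ∀ p → p ≤ s → deg (E (suc m)) (V i p) ≡ cycleDegree (0 <ᵇ i) (i <ᵇ m) p
    δ≡ p = deg-vid m i p i≤m

  sum-irregularity-cactusChain : ∀ m →
    sum (map (irregularity (E (2 + m))) (E (2 + m)))
      ≡ blockIrregularity false true + (m * blockIrregularity true true + blockIrregularity true false)
  sum-irregularity-cactusChain m = begin
    sum (map w (E (2 + m)))
      ≡⟨ sum-map-cactusChain w (2 + m) ⟩
    ∑ (2 + m) (λ i → sum (map w (block k d i)))
      ≡⟨ ∑-cong (2 + m) (λ i i<n → sum-irregularity-block (suc m) i (≤-pred i<n)) ⟩
    B false true + ∑ (suc m) (λ i → B true (i <ᵇ m))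
      ≡⟨ cong (B false true +_) (∑-last m (λ i → B true (i <ᵇ m))) ⟩
    B false true + (∑ m (λ i → B true (i <ᵇ m)) + B true (m <ᵇ m))
      ≡⟨ cong (B false true +_) (cong₂ _+_ inner final) ⟩
    B false true + (m * B true true + B true false) ∎
    where
    w : ℕ × ℕ → ℕ
    w = irregularity (E (2 + m))
    B : Bool → Bool → ℕ
    B = blockIrregularity
    inner : ∑ m (λ i → B true (i <ᵇ m)) ≡ m * B true true
    inner = trans (∑-cong m (λ i i<m → cong (B true) (dec-true (i <? m) i<m)))
                  (∑-const m (B true true))
    final : B true (m <ᵇ m) ≡ B true false
    final = cong (B true) (dec-false (m <? m) (n≮n m))

  SO1-cactusChain : ∀ m → SO1 (E (2 + m)) ≡
    (blockIrregularity false true + (m * blockIrregularity true true + blockIrregularity true false)) / 2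
  SO1-cactusChain m =
    trans (SO1-irregularity (E (2 + m))) (cong (_/ 2) (sum-irregularity-cactusChain m))

half-of-24-per-block : ∀ m → (24 + (m * 24 + 24)) / 2 ≡ 12 * (2 + m)
half-of-24-per-block m = trans (cong (_/ 2) (double m)) (m*n/n≡m (12 * (2 + m)) 2)
  where
  double : ∀ m → 24 + (m * 24 + 24) ≡ 12 * (2 + m) * 2
  double = solve-∀

half-of-48-per-inner-block : ∀ m → (24 + (m * 48 + 24)) / 2 ≡ 24 * (2 + m) ∸ 24
half-of-48-per-inner-block m = begin
  (24 + (m * 48 + 24)) / 2 ≡⟨ cong (_/ 2) (double m) ⟩
  (24 + m * 24) * 2 / 2    ≡⟨ m*n/n≡m (24 + m * 24) 2 ⟩
  24 + m * 24              ≡⟨ sym (m+n∸m≡n 24 (24 + m * 24)) ⟩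
  24 + (24 + m * 24) ∸ 24  ≡⟨ cong (_∸ 24) (expand m) ⟩
  24 * (2 + m) ∸ 24        ∎
  where
  double : ∀ m → 24 + (m * 48 + 24) ≡ (24 + m * 24) * 2
  double = solve-∀
  expand : ∀ m → 24 + (24 + m * 24) ≡ 24 * (2 + m)
  expand = solve-∀

theorem2p3 : (n : ℕ) → 2 ≤ n →
    (SO1 (T n) ≡ 12 * n)
    × (SO1 (Q n) ≡ 24 * n ∸ 24)
    × (SO1 (O n) ≡ 12 * n)
    × (SO1 (Oh n) ≡ 12 * n)
    × (SO1 (L n) ≡ 24 * n ∸ 24)
    × (SO1 (M n) ≡ 24 * n ∸ 24)
theorem2p3 (suc (suc m)) (s≤s (s≤s z≤n)) =
    trans (CactusChain.SO1-cactusChain 2 0 z<s m) (half-of-24-per-block m)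
  , trans (CactusChain.SO1-cactusChain 3 1 (s<s z<s) m) (half-of-48-per-inner-block m)
  , trans (CactusChain.SO1-cactusChain 3 0 z<s m) (half-of-24-per-block m)
  , trans (CactusChain.SO1-cactusChain 5 0 z<s m) (half-of-24-per-block m)
  , trans (CactusChain.SO1-cactusChain 5 2 (s<s (s<s z<s)) m) (half-of-48-per-inner-block m)
  , trans (CactusChain.SO1-cactusChain 5 1 (s<s z<s) m) (half-of-48-per-inner-block m)
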